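{- There is no $\mathsf{TOTO}$ formula $\phi(x)$ with one free variable such that for every permutation $\sigma$ and every element $a$ of $\sigma$, $(\sigma,a)\models\phi(x)$ if and only if $a$ is a fixed point of $\sigma$.
   Context: A permutation $\sigma$ of size $n$ is identified with the finite structure whose domain (set of elements) is $A^\sigma=\{(i,\sigma(i)) : 1\le i\le n\}$, with position order $<_P$ (comparing first coordinates) and value order $<_V$ (comparing second coordinates); $\mathsf{TOTO}$ is first-order logic (with equality) over the signature $\{<_P,<_V\}$. An element $(i,\sigma(i))$ is a fixed point if $\sigma(i)=i$. -}

module Defs where

open import Data.Nat using (ℕ; suc)
open import Data.Fin using (Fin; zero; suc; _<_)
open import Data.Fin.Permutation using (Permutation′; _⟨$⟩ʳ_)
open import Data.Product using (Σ; _×_)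
open import Data.Sum using (_⊎_)
open import Data.Empty using (⊥)
open import Data.Unit using (⊤)
open import Relation.Binary.PropositionalEquality using (_≡_)
open import Relation.Nullary using (¬_)

data Formula (k : ℕ) : Set where
  _≐_  : Fin k → Fin k → Formula k
  _<P_ : Fin k → Fin k → Formula k
  _<V_ : Fin k → Fin k → Formula k
  ⊤f ⊥f : Formula k
  ¬f   : Formula k → Formula k
  _∧f_ _∨f_ _⇒f_ : Formula k → Formula k → Formula k
  ∀f ∃f : Formula (suc k) → Formula k

-- Its element (i, σ(i)) is
-- represented by its position i : Fin n (the map i ↦ (i, σ i) is a
-- bijection onto the domain A^σ). Position order compares i, value order
-- compares σ i. (Fin is 0-indexed; this is a harmless shift.)
Elem : {n : ℕ} → Permutation′ n → Set
Elem {n} σ = Fin n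

_<P[_]_ : {n : ℕ} → Fin n → Permutation′ n → Fin n → Set
i <P[ σ ] j = i < j

_<V[_]_ : {n : ℕ} → Fin n → Permutation′ n → Fin n → Set
i <V[ σ ] j = (σ ⟨$⟩ʳ i) < (σ ⟨$⟩ʳ j)

_∷ₑ_ : {A : Set} {k : ℕ} → A → (Fin k → A) → Fin (suc k) → A
(a ∷ₑ ρ) zero    = a
(a ∷ₑ ρ) (suc x) = ρ x

Sat : {n k : ℕ} (σ : Permutation′ n) → Formula k → (Fin k → Elem σ) → Set
Sat σ (x ≐ y)   ρ = ρ x ≡ ρ y
Sat σ (x <P y)  ρ = ρ x <P[ σ ] ρ y
Sat σ (x <V y)  ρ = ρ x <V[ σ ] ρ y
Sat σ ⊤f        ρ = ⊤
Sat σ ⊥f        ρ = ⊥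
Sat σ (¬f φ)    ρ = ¬ Sat σ φ ρ
Sat σ (φ ∧f ψ)  ρ = Sat σ φ ρ × Sat σ ψ ρ
Sat σ (φ ∨f ψ)  ρ = Sat σ φ ρ ⊎ Sat σ ψ ρ
Sat σ (φ ⇒f ψ)  ρ = Sat σ φ ρ → Sat σ ψ ρ
Sat σ (∀f φ)    ρ = (a : Elem σ) → Sat σ φ (a ∷ₑ ρ)
Sat σ (∃f φ)    ρ = Σ (Elem σ) (λ a → Sat σ φ (a ∷ₑ ρ))

_,_⊨_ : {n : ℕ} (σ : Permutation′ n) → Elem σ → Formula 1 → Set
σ , a ⊨ φ = Sat σ φ (λ _ → a)

IsFixedPoint : {n : ℕ} (σ : Permutation′ n) → Elem σ → Set
IsFixedPoint σ a = σ ⟨$⟩ʳ a ≡ a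

-- For the reversal σ(i) = n + 1 − i the value order is the converse of the position
-- order, so a formula about reversals only talks about a finite linear order. By the
-- Ehrenfeucht–Fraïssé argument for linear orders, two tuples whose gap patterns (the
-- endpoints 0 and n + 1 included) agree up to 2^d satisfy the same formulas of
-- quantifier depth d: each quantifier step matches a new point while halving the
-- threshold. With t = 2^d, the middle element of the reversal of size 2t + 1 is a fixed
-- point, and it has a partner in the reversal of size 2t + 2 satisfying the same
-- depth-d formulas; but reversals of even size have no fixed points.

module Submission where

open import Data.Fin using (Fin; zero; suc; toℕ; fromℕ<; opposite)
open import Data.Fin.Permutation using (Permutation′; reverse)
open import Data.Fin.Properties using (toℕ-injective; toℕ<n; toℕ-fromℕ<; opposite-prop)
open import Data.List using (List; []; _∷_; map; allFin)
open import Data.List.Membership.Propositional using (_∈_; lose)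
open import Data.List.Membership.Propositional.Properties using (∈-map⁺; ∈-allFin)
open import Data.List.Relation.Unary.Any using (here; there; any?; satisfied)
open import Data.Maybe using (Maybe; just; nothing; maybe′)
open import Data.Nat using (ℕ; suc; _+_; _*_; _^_; _∸_; _⊔_; _≤_; _<_; z≤n; s≤s; s≤s⁻¹; s<s⁻¹)
open import Data.Nat.Properties
open import Algebra.Properties.CommutativeSemigroup +-commutativeSemigroup using (x∙yz≈y∙xz)
open import Data.Empty using (⊥-elim)
open import Data.Product using (Σ; ∃; ∃₂; _×_; _,_; proj₁; proj₂)
open import Data.Product.Function.NonDependent.Propositional using (_×-⇔_)
open import Data.Sum using (_⊎_; inj₁; inj₂)
open import Data.Sum.Function.Propositional using (_⊎-⇔_)
open import Function using (_∘_; id)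
open import Function.Bundles using (_⇔_; mk⇔; Equivalence)
open import Function.Properties.Equivalence using () renaming (sym to ⇔-sym; trans to ⇔-trans)
open import Function.Related.Propositional using (module EquationalReasoning)
open import Function.Related.TypeIsomorphisms using (→-cong-⇔; ¬-cong-⇔)
open import Relation.Binary.PropositionalEquality using (_≡_; refl; sym; trans; cong; cong₂; subst; _≗_; module ≡-Reasoning)
open import Relation.Nullary using (¬_; yes; no; contradiction)
open import Relation.Nullary.Decidable using (_×-dec_)

open import Defs

open Equivalence using (to; from)

private
  variable
    I J : Set
    f g f′ g′ : I → ℕ
    k n n′ : ℕ

⇔-both : {A B : Set} → A → B → A ⇔ B
⇔-both a b = mk⇔ (λ _ → b) (λ _ → a)

⇔-neither : {A B : Set} → ¬ A → ¬ B → A ⇔ B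
⇔-neither ¬a ¬b = mk⇔ (⊥-elim ∘ ¬a) (⊥-elim ∘ ¬b)

≤⇔≯ : ∀ {m n} → (m ≤ n) ⇔ (¬ n < m)
≤⇔≯ = mk⇔ ≤⇒≯ ≮⇒≥

+-cancelˡ-⇔ : ∀ k {m n} → (k + m ≤ k + n) ⇔ (m ≤ n)
+-cancelˡ-⇔ k = mk⇔ (+-cancelˡ-≤ k _ _) (+-monoʳ-≤ k)

+-≤-self-⇔ : ∀ c m n → (c + m ≤ m) ⇔ (c + n ≤ n)
+-≤-self-⇔ c m n = ⇔-trans (c+≤⇔c≡0 m) (⇔-sym (c+≤⇔c≡0 n))
  where
  c+≤⇔c≡0 : ∀ m → (c + m ≤ m) ⇔ (c ≡ 0)
  c+≤⇔c≡0 m = mk⇔ (λ c+m≤m → n≤0⇒n≡0 (+-cancelʳ-≤ m c 0 c+m≤m)) (λ { refl → ≤-refl })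

-- c + f i ≤ f j says that the gap from f i up to f j is at least c, so Agree t f g
-- states that f and g have the same order and the same gaps, gaps beyond t being
-- identified.
Agree : ℕ → (I → ℕ) → (I → ℕ) → Set
Agree t f g = ∀ i j c → c ≤ t → (c + f i ≤ f j) ⇔ (c + g i ≤ g j)

Agree-sym : ∀ {t} → Agree {I} t f g → Agree t g f
Agree-sym A i j c c≤t = ⇔-sym (A i j c c≤t)

Agree-mono : ∀ {s t} → s ≤ t → Agree {I} t f g → Agree s f g
Agree-mono s≤t A i j c c≤s = A i j c (≤-trans c≤s s≤t)

Agree-pullback : ∀ {t} (h : J → I) → f′ ≗ f ∘ h → g′ ≗ g ∘ h → Agree t f g → Agree t f′ g′
Agree-pullback h f′≗ g′≗ A i j c c≤t rewrite f′≗ i | f′≗ j | g′≗ i | g′≗ j = A (h i) (h j) c c≤t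

Agree-≤ : ∀ {t} → Agree {I} t f g → ∀ i j → (f i ≤ f j) ⇔ (g i ≤ g j)
Agree-≤ A i j = A i j 0 z≤n

Agree-< : ∀ {t} → 1 ≤ t → Agree {I} t f g → ∀ i j → (f i < f j) ⇔ (g i < g j)
Agree-< 1≤t A i j = A i j 1 1≤t

Agree-≡ : ∀ {t} → Agree {I} t f g → ∀ i j → (f i ≡ f j) ⇔ (g i ≡ g j)
Agree-≡ {f = f} {g} A i j =
  ⇔-trans ≡⇔≤×≥ (⇔-trans (Agree-≤ A i j ×-⇔ Agree-≤ A j i) (⇔-sym ≡⇔≤×≥))
  where
  ≡⇔≤×≥ : ∀ {m n} → (m ≡ n) ⇔ (m ≤ n × n ≤ m)
  ≡⇔≤×≥ = mk⇔ (λ { refl → ≤-refl , ≤-refl }) (λ (m≤n , n≤m) → ≤-antisym m≤n n≤m)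

shift-≤-left : ∀ {c e d} u v → e + d ≡ c → (c + u ≤ e + v) ⇔ (d + u ≤ v)
shift-≤-left {e = e} {d} u v refl = begin
  e + d + u ≤ e + v     ≡⟨ cong (_≤ e + v) (+-assoc e d u) ⟩
  e + (d + u) ≤ e + v   ∼⟨ +-cancelˡ-⇔ e ⟩
  d + u ≤ v             ∎
  where open EquationalReasoning

shift-≤-right : ∀ {c e d} u v → c + d ≡ e → (c + u ≤ e + v) ⇔ (¬ suc d + v ≤ u)
shift-≤-right {c} {d = d} u v refl = begin
  c + u ≤ c + d + v     ≡⟨ cong (c + u ≤_) (+-assoc c d v) ⟩
  c + u ≤ c + (d + v)   ∼⟨ +-cancelˡ-⇔ c ⟩
  u ≤ d + v             ∼⟨ ≤⇔≯ ⟩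
  (¬ suc d + v ≤ u)     ∎
  where open EquationalReasoning

Agree-offset : ∀ {s} → Agree {I} s f g → ∀ i j {c e} → c ≤ e + s → e < c + s →
               (c + f i ≤ e + f j) ⇔ (c + g i ≤ e + g j)
Agree-offset {f = f} {g} {s} A i j {c} {e} c≤e+s e<c+s with ≤-total e c
... | inj₁ e≤c with d , refl ← m≤n⇒∃[o]m+o≡n e≤c =
  ⇔-trans (shift-≤-left (f i) (f j) refl)
    (⇔-trans (A i j d (+-cancelˡ-≤ e d s c≤e+s)) (⇔-sym (shift-≤-left (g i) (g j) refl)))
... | inj₂ c≤e with d , refl ← m≤n⇒∃[o]m+o≡n c≤e =
  ⇔-trans (shift-≤-right (f i) (f j) refl)
    (⇔-trans (¬-cong-⇔ (A j i (suc d) (+-cancelˡ-< c d s e<c+s))) (⇔-sym (shift-≤-right (g i) (g j) refl)))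

apart-below : ∀ {t u x} → t + u < x ⊎ t + x < u → u ≤ x → t + u < x
apart-below (inj₁ t+u<x) _   = t+u<x
apart-below {t} {u} {x} (inj₂ t+x<u) u≤x = contradiction u≤x (<⇒≱ (≤-<-trans (m≤n+m x t) t+x<u))

apart-above : ∀ {t u x} → t + u < x ⊎ t + x < u → ¬ u ≤ x → t + x < u
apart-above {t} {u} (inj₁ t+u<x) u≰x = contradiction (<⇒≤ (≤-<-trans (m≤n+m u t) t+u<x)) u≰x
apart-above (inj₂ t+x<u) _   = t+x<u

AgreeAt : ℕ → (I → ℕ) → (I → ℕ) → ℕ → ℕ → Set
AgreeAt t f g x x′ =
  ∀ i c → c ≤ t → ((c + f i ≤ x) ⇔ (c + g i ≤ x′)) × ((c + x ≤ f i) ⇔ (c + x′ ≤ g i))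

Agree-maybe : ∀ {t x x′} → Agree {I} t f g → AgreeAt t f g x x′ → Agree t (maybe′ f x) (maybe′ g x′)
Agree-maybe A B (just i) (just j) = A i j
Agree-maybe A B (just i) nothing c c≤t = proj₁ (B i c c≤t)
Agree-maybe A B nothing (just j) c c≤t = proj₂ (B j c c≤t)
Agree-maybe {x = x} {x′} A B nothing nothing c _ = +-≤-self-⇔ c x x′

maximum-below : (f : I → ℕ) (xs : List I) {x : ℕ} {d : I} → f d ≤ x →
                ∃ λ p → f p ≤ x × (∀ {i} → i ∈ xs → f i ≤ x → f i ≤ f p)
maximum-below f [] fd≤x = _ , fd≤x , λ ()
maximum-below f (j ∷ xs) {x} fd≤x with maximum-below f xs fd≤x
... | p , fp≤x , max with f j ≤? x | f p ≤? f j
...   | yes fj≤x | yes fp≤fj = j , fj≤x , λ { (here refl) _      → ≤-refl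
                                          ; (there i∈xs) fi≤x → ≤-trans (max i∈xs fi≤x) fp≤fj }
...   | yes _    | no fp≰fj  = p , fp≤x , λ { (here refl) _      → <⇒≤ (≰⇒> fp≰fj)
                                          ; (there i∈xs)      → max i∈xs }
...   | no fj≰x  | _         = p , fp≤x , λ { (here refl) fj≤x   → contradiction fj≤x fj≰x
                                          ; (there i∈xs)      → max i∈xs }

close⇒offsets : ∀ {t u v} → u ≤ t + v × v ≤ t + u →
                ∃₂ λ e₁ e₂ → e₁ ≤ t × e₂ ≤ t × e₁ + v ≡ e₂ + u
close⇒offsets {t} {u} {v} (u≤t+v , v≤t+u) with ≤-total u v
... | inj₁ u≤v =
  0 , v ∸ u , z≤n , m≤n+o⇒m∸n≤o v u (subst (v ≤_) (+-comm t u) v≤t+u) , sym (m∸n+n≡m u≤v)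
... | inj₂ v≤u =
  u ∸ v , 0 , m≤n+o⇒m∸n≤o u v (subst (u ≤_) (+-comm t v) u≤t+v) , z≤n , m∸n+n≡m v≤u

¬close⇒apart : ∀ {t u v} → ¬ (u ≤ t + v × v ≤ t + u) → t + u < v ⊎ t + v < u
¬close⇒apart {t} {u} {v} ¬close with u ≤? t + v
... | no u≰t+v  = inj₂ (≰⇒> u≰t+v)
... | yes u≤t+v = inj₁ (≰⇒> (λ v≤t+u → ¬close (u≤t+v , v≤t+u)))

module Extension {I : Set} {t : ℕ} (1≤t : 1 ≤ t) {f g : I → ℕ} (A₂ : Agree (2 * t) f g) where

  private
    A : Agree (t + t) f g
    A = Agree-mono (≤-reflexive (cong (t +_) (sym (+-identityʳ t)))) A₂

    ≤-+double : ∀ {a} k → a ≤ t + t → a ≤ k + (t + t)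
    ≤-+double k a≤2t = ≤-trans a≤2t (m≤n+m _ k)

    <-+double : ∀ {a} k → a ≤ t → a < k + (t + t)
    <-+double k a≤t = ≤-<-trans a≤t (<-≤-trans (m<m+n t 1≤t) (m≤n+m _ k))

  near-AgreeAt : ∀ {p x x′ e₁ e₂} → e₁ ≤ t → e₂ ≤ t →
                 e₁ + x ≡ e₂ + f p → e₁ + x′ ≡ e₂ + g p → AgreeAt t f g x x′
  near-AgreeAt {p} {x} {x′} {e₁} {e₂} e₁≤t e₂≤t x≡ x′≡ i c c≤t =
    ⇔-trans (below f x≡)
      (⇔-trans (Agree-offset A i p below-bound (<-+double (e₁ + c) e₂≤t)) (⇔-sym (below g x′≡))) ,
    ⇔-trans (above f x≡)
      (⇔-trans (Agree-offset A p i above-bound (<-+double (c + e₂) e₁≤t)) (⇔-sym (above g x′≡)))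
    where
    open EquationalReasoning
    below-bound : e₁ + c ≤ e₂ + (t + t)
    below-bound = ≤-+double e₂ (+-mono-≤ e₁≤t c≤t)
    above-bound : c + e₂ ≤ e₁ + (t + t)
    above-bound = ≤-+double e₁ (+-mono-≤ c≤t e₂≤t)
    below : ∀ (h : I → ℕ) {y} → e₁ + y ≡ e₂ + h p → (c + h i ≤ y) ⇔ (e₁ + c + h i ≤ e₂ + h p)
    below h {y} y≡ = begin
      c + h i ≤ y              ∼⟨ ⇔-sym (+-cancelˡ-⇔ e₁) ⟩
      e₁ + (c + h i) ≤ e₁ + y  ≡⟨ cong₂ _≤_ (sym (+-assoc e₁ c (h i))) y≡ ⟩
      e₁ + c + h i ≤ e₂ + h p  ∎
    above : ∀ (h : I → ℕ) {y} → e₁ + y ≡ e₂ + h p → (c + y ≤ h i) ⇔ (c + e₂ + h p ≤ e₁ + h i)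
    above h {y} y≡ = begin
      c + y ≤ h i              ∼⟨ ⇔-sym (+-cancelˡ-⇔ e₁) ⟩
      e₁ + (c + y) ≤ e₁ + h i  ≡⟨ cong (_≤ e₁ + h i) (x∙yz≈y∙xz e₁ c y) ⟩
      c + (e₁ + y) ≤ e₁ + h i  ≡⟨ cong (λ z → c + z ≤ e₁ + h i) y≡ ⟩
      c + (e₂ + h p) ≤ e₁ + h i  ≡⟨ cong (_≤ e₁ + h i) (sym (+-assoc c e₂ (h p))) ⟩
      c + e₂ + h p ≤ e₁ + h i  ∎

  far-AgreeAt : ∀ {p x} → f p ≤ x → (∀ {i} → f i ≤ x → f i ≤ f p) →
                (∀ i → t + f i < x ⊎ t + x < f i) → AgreeAt t f g x (t + g p)
  far-AgreeAt {p} {x} fp≤x maximal apart i c c≤t with f i ≤? x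
  ... | yes fi≤x =
    ⇔-both (≤-trans (+-monoˡ-≤ (f i) c≤t) (<⇒≤ (apart-below (apart i) fi≤x))) (+-mono-≤ c≤t gi≤gp) ,
    ⇔-neither (λ c+x≤fi → <⇒≱ (≤-<-trans (m≤n+m (f i) t) (apart-below (apart i) fi≤x))
                                (m+n≤o⇒n≤o c c+x≤fi))
              (λ c+x′≤gi → <⇒≱ (m<n+m (g p) 1≤t) (≤-trans (m+n≤o⇒n≤o c c+x′≤gi) gi≤gp))
    where
    gi≤gp : g i ≤ g p
    gi≤gp = to (Agree-≤ A i p) (maximal fi≤x)
  ... | no fi≰x =
    ⇔-neither (λ c+fi≤x → fi≰x (m+n≤o⇒n≤o c c+fi≤x))
              (λ c+gi≤x′ → <⇒≱ (m<n+m (t + g p) 1≤t) (≤-trans gap (m+n≤o⇒n≤o c c+gi≤x′))) ,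
    ⇔-both (≤-trans (+-monoˡ-≤ x c≤t) (<⇒≤ (apart-above (apart i) fi≰x)))
           (≤-trans (+-monoˡ-≤ (t + g p) c≤t) gap)
    where
    gap : t + (t + g p) ≤ g i
    gap = subst (_≤ g i) (+-assoc t t (g p))
            (to (A p i (t + t) ≤-refl)
              (subst (_≤ f i) (sym (+-assoc t t (f p)))
                (≤-trans (+-monoʳ-≤ t (<⇒≤ (apart-below (apart p) fp≤x))) (<⇒≤ (apart-above (apart i) fi≰x)))))

  -- A new point x close to some f p is copied at the same offset from g p; otherwise it
  -- is placed at distance t above the image of the largest f p below x.
  extend : (xs : List I) → (∀ i → i ∈ xs) → ∀ {o} → f o ≡ 0 →
           ∀ x → ∃ λ x′ → Agree t (maybe′ f x) (maybe′ g x′)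
  extend xs ∈xs {o} fo≡0 x with any? (λ p → (f p ≤? t + x) ×-dec (x ≤? t + f p)) xs
  ... | yes near with p , close ← satisfied near with e₁ , e₂ , e₁≤t , e₂≤t , x≡ ← close⇒offsets close =
    e₂ + g p ∸ e₁ ,
    Agree-maybe (Agree-mono (m≤m+n t t) A) (near-AgreeAt e₁≤t e₂≤t x≡ (m+[n∸m]≡n e₁≤e₂+gp))
    where
    -- Comparing with the origin o shows that the subtraction does not truncate.
    e₁≤e₂+gp : e₁ ≤ e₂ + g p
    e₁≤e₂+gp = ≤-trans (m≤m+n e₁ (g o))
      (to (Agree-offset A o p (≤-+double e₂ (≤-trans e₁≤t (m≤m+n t t))) (<-+double e₁ e₂≤t))
        (≤-trans (+-monoʳ-≤ e₁ (subst (_≤ x) (sym fo≡0) z≤n)) (≤-reflexive x≡)))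
  ... | no far with p , fp≤x , maximal ← maximum-below f xs (subst (_≤ x) (sym fo≡0) z≤n) =
    t + g p , Agree-maybe (Agree-mono (m≤m+n t t) A) (far-AgreeAt fp≤x (maximal (∈xs _)) apart)
    where
    apart : ∀ i → t + f i < x ⊎ t + x < f i
    apart i = ¬close⇒apart (λ close → far (lose (∈xs i) close))

data Point (k : ℕ) : Set where
  lo hi : Point k
  var   : Fin k → Point k

points : ∀ k → List (Point k)
points k = lo ∷ hi ∷ map var (allFin k)

∈-points : (p : Point k) → p ∈ points k
∈-points lo      = here refl
∈-points hi      = there (here refl)
∈-points (var x) = there (there (∈-map⁺ var (∈-allFin x)))

-- An assignment into a permutation of size n as points of ℕ, bracketed by 0 and n + 1;
-- these endpoints keep an extended point inside the range of Fin n.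
place : (Fin k → Fin n) → Point k → ℕ
place     ρ lo      = 0
place {n = n} ρ hi  = suc n
place     ρ (var x) = suc (toℕ (ρ x))

place-cong : {ρ ρ′ : Fin k → Fin n} → ρ ≗ ρ′ → place ρ ≗ place ρ′
place-cong ρ≗ρ′ lo      = refl
place-cong ρ≗ρ′ hi      = refl
place-cong ρ≗ρ′ (var x) = cong (suc ∘ toℕ) (ρ≗ρ′ x)

pop : Point (suc k) → Maybe (Point k)
pop lo            = just lo
pop hi            = just hi
pop (var zero)    = nothing
pop (var (suc x)) = just (var x)

place-∷ : {a : Fin n} {ρ : Fin k → Fin n} {x : ℕ} → suc (toℕ a) ≡ x →
          place (a ∷ₑ ρ) ≗ maybe′ (place ρ) x ∘ pop
place-∷ a↦x lo            = refl
place-∷ a↦x hi            = refl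
place-∷ a↦x (var zero)    = a↦x
place-∷ a↦x (var (suc y)) = refl

suc-toℕ-onto : ∀ {x} → 1 ≤ x → x ≤ n → ∃ λ (a : Fin n) → suc (toℕ a) ≡ x
suc-toℕ-onto {x = suc y} _ y<n = fromℕ< y<n , cong suc (toℕ-fromℕ< y<n)

extend-place : ∀ {t} {ρ : Fin k → Fin n} {ρ′ : Fin k → Fin n′} →
               1 ≤ t → Agree (2 * t) (place ρ) (place ρ′) →
               (a : Fin n) → ∃ λ a′ → Agree t (place (a ∷ₑ ρ)) (place (a′ ∷ₑ ρ′))
extend-place {k} 1≤t A a with x′ , B ← Extension.extend 1≤t A (points k) ∈-points {lo} refl (suc (toℕ a))
  with a′ , a′↦x′ ← suc-toℕ-onto (to (B (just lo) nothing 1 1≤t) (s≤s z≤n))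
                            (s≤s⁻¹ (to (B nothing (just hi) 1 1≤t) (s≤s (toℕ<n a))))
  = a′ , Agree-pullback pop (place-∷ refl) (place-∷ a′↦x′) B

depth : Formula k → ℕ
depth (x ≐ y)  = 0
depth (x <P y) = 0
depth (x <V y) = 0
depth ⊤f       = 0
depth ⊥f       = 0
depth (¬f φ)   = depth φ
depth (φ ∧f ψ) = depth φ ⊔ depth ψ
depth (φ ∨f ψ) = depth φ ⊔ depth ψ
depth (φ ⇒f ψ) = depth φ ⊔ depth ψ
depth (∀f φ)   = suc (depth φ)
depth (∃f φ)   = suc (depth φ)

opposite-<⇔ : (i j : Fin n) → (toℕ (opposite i) < toℕ (opposite j)) ⇔ (toℕ j < toℕ i)
opposite-<⇔ {n} i j rewrite opposite-prop i | opposite-prop j =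
  mk⇔ (s<s⁻¹ ∘ ∸-cancelʳ-< {o = n}) (λ j<i → ∸-monoʳ-< (s≤s j<i) (toℕ<n i))

module _ {ρ : Fin k → Fin n} where

  var-≡⇔ : ∀ x y → (ρ x ≡ ρ y) ⇔ (place ρ (var x) ≡ place ρ (var y))
  var-≡⇔ x y = mk⇔ (cong (suc ∘ toℕ)) (toℕ-injective ∘ suc-injective)

  var-<⇔ : ∀ x y → (toℕ (ρ x) < toℕ (ρ y)) ⇔ (place ρ (var x) < place ρ (var y))
  var-<⇔ x y = mk⇔ s≤s s≤s⁻¹

∀-cong-along : {A A′ : Set} {P : A → Set} {Q : A′ → Set} →
               (∀ a → ∃ λ a′ → P a ⇔ Q a′) → (∀ a′ → ∃ λ a → Q a′ ⇔ P a) →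
               (∀ a → P a) ⇔ (∀ a′ → Q a′)
∀-cong-along forth back =
  mk⇔ (λ ∀P a′ → let a , Q⇔P = back a′ in from Q⇔P (∀P a))
      (λ ∀Q a → let a′ , P⇔Q = forth a in from P⇔Q (∀Q a′))

∃-cong-along : {A A′ : Set} {P : A → Set} {Q : A′ → Set} →
               (∀ a → ∃ λ a′ → P a ⇔ Q a′) → (∀ a′ → ∃ λ a → Q a′ ⇔ P a) →
               (∃ λ a → P a) ⇔ (∃ λ a′ → Q a′)
∃-cong-along forth back =
  mk⇔ (λ (a , Pa) → let a′ , P⇔Q = forth a in a′ , to P⇔Q Pa)
      (λ (a′ , Qa′) → let a , Q⇔P = back a′ in a , to Q⇔P Qa′)

Agree-⊔ : ∀ d e → Agree {I} (2 ^ (d ⊔ e)) f g → Agree (2 ^ d) f g × Agree (2 ^ e) f g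
Agree-⊔ d e A = Agree-mono (^-monoʳ-≤ 2 (m≤m⊔n d e)) A , Agree-mono (^-monoʳ-≤ 2 (m≤n⊔m d e)) A

reverse-Sat-⇔ : (φ : Formula k) {ρ : Fin k → Fin n} {ρ′ : Fin k → Fin n′} →
                Agree (2 ^ depth φ) (place ρ) (place ρ′) → Sat reverse φ ρ ⇔ Sat reverse φ ρ′
reverse-Sat-∷-⇔ : (φ : Formula (suc k)) {ρ : Fin k → Fin n} {ρ′ : Fin k → Fin n′} →
                  Agree (2 * 2 ^ depth φ) (place ρ) (place ρ′) →
                  ∀ a → ∃ λ a′ → Sat reverse φ (a ∷ₑ ρ) ⇔ Sat reverse φ (a′ ∷ₑ ρ′)

reverse-Sat-⇔ (x ≐ y) A =
  ⇔-trans (var-≡⇔ x y) (⇔-trans (Agree-≡ A (var x) (var y)) (⇔-sym (var-≡⇔ x y)))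
reverse-Sat-⇔ (x <P y) A =
  ⇔-trans (var-<⇔ x y) (⇔-trans (Agree-< ≤-refl A (var x) (var y)) (⇔-sym (var-<⇔ x y)))
reverse-Sat-⇔ (x <V y) {ρ} {ρ′} A =
  ⇔-trans (opposite-<⇔ (ρ x) (ρ y))
    (⇔-trans (reverse-Sat-⇔ (y <P x) A) (⇔-sym (opposite-<⇔ (ρ′ x) (ρ′ y))))
reverse-Sat-⇔ ⊤f A = mk⇔ id id
reverse-Sat-⇔ ⊥f A = mk⇔ id id
reverse-Sat-⇔ (¬f φ) A = ¬-cong-⇔ (reverse-Sat-⇔ φ A)
reverse-Sat-⇔ (φ ∧f ψ) A with A₁ , A₂ ← Agree-⊔ (depth φ) (depth ψ) A =
  _×-⇔_ (reverse-Sat-⇔ φ A₁) (reverse-Sat-⇔ ψ A₂)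
reverse-Sat-⇔ (φ ∨f ψ) A with A₁ , A₂ ← Agree-⊔ (depth φ) (depth ψ) A =
  _⊎-⇔_ (reverse-Sat-⇔ φ A₁) (reverse-Sat-⇔ ψ A₂)
reverse-Sat-⇔ (φ ⇒f ψ) A with A₁ , A₂ ← Agree-⊔ (depth φ) (depth ψ) A =
  →-cong-⇔ (reverse-Sat-⇔ φ A₁) (reverse-Sat-⇔ ψ A₂)
reverse-Sat-⇔ (∀f φ) A = ∀-cong-along (reverse-Sat-∷-⇔ φ A) (reverse-Sat-∷-⇔ φ (Agree-sym A))
reverse-Sat-⇔ (∃f φ) A = ∃-cong-along (reverse-Sat-∷-⇔ φ A) (reverse-Sat-∷-⇔ φ (Agree-sym A))

reverse-Sat-∷-⇔ φ A a with a′ , A′ ← extend-place (m^n>0 2 (depth φ)) A a = a′ , reverse-Sat-⇔ φ A′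

ends-Agree : ∀ {t} {ρ : Fin 0 → Fin n} {ρ′ : Fin 0 → Fin n′} → t ≤ suc n → t ≤ suc n′ →
             Agree t (place ρ) (place ρ′)
ends-Agree _ _ lo lo c _ = +-≤-self-⇔ c 0 0
ends-Agree _ _ hi hi c _ = +-≤-self-⇔ c _ _
ends-Agree t≤1+n t≤1+n′ lo hi c c≤t = ⇔-both (below t≤1+n) (below t≤1+n′)
  where
  below : ∀ {m} → _ ≤ suc m → c + 0 ≤ suc m
  below t≤1+m = subst (_≤ _) (sym (+-identityʳ c)) (≤-trans c≤t t≤1+m)
ends-Agree _ _ hi lo c _ = ⇔-neither (n≮0 ∘ m+n≤o⇒n≤o c) (n≮0 ∘ m+n≤o⇒n≤o c)

const≗∷ₑ : {a : Fin n} {ρ : Fin 0 → Fin n} → (λ (_ : Fin 1) → a) ≗ (a ∷ₑ ρ)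
const≗∷ₑ zero = refl

reverse-fixed⇒odd : (a : Fin n) → IsFixedPoint reverse a → n ≡ suc (2 * toℕ a)
reverse-fixed⇒odd {n} a fixed = begin
  n                               ≡⟨ m∸n+n≡m (toℕ<n a) ⟨
  n ∸ suc (toℕ a) + suc (toℕ a)   ≡⟨ cong (_+ suc (toℕ a)) (trans (sym (opposite-prop a)) (cong toℕ fixed)) ⟩
  toℕ a + suc (toℕ a)             ≡⟨ +-suc (toℕ a) (toℕ a) ⟩
  suc (toℕ a + toℕ a)             ≡⟨ cong (λ m → suc (toℕ a + m)) (+-identityʳ (toℕ a)) ⟨
  suc (2 * toℕ a)                 ∎
  where open ≡-Reasoning

middle : ∀ t → Fin (suc (2 * t))
middle t = fromℕ< (s≤s (m≤m+n t (t + 0)))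

reverse-fixes-middle : ∀ t → IsFixedPoint reverse (middle t)
reverse-fixes-middle t = toℕ-injective (begin
  toℕ (opposite (middle t))  ≡⟨ opposite-prop (middle t) ⟩
  2 * t ∸ toℕ (middle t)     ≡⟨ cong (2 * t ∸_) toℕ-middle ⟩
  t + (t + 0) ∸ t            ≡⟨ m+n∸m≡n t (t + 0) ⟩
  t + 0                      ≡⟨ +-identityʳ t ⟩
  t                          ≡⟨ toℕ-middle ⟨
  toℕ (middle t)             ∎)
  where
  open ≡-Reasoning
  toℕ-middle : toℕ (middle t) ≡ t
  toℕ-middle = toℕ-fromℕ< _

proposition4p7 : ¬ (Σ (Formula 1) (λ φ → (n : ℕ) (σ : Permutation′ n) (a : Elem σ) → ((σ , a ⊨ φ) ⇔ IsFixedPoint σ a)))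
proposition4p7 (φ , φ-defines) =
  even≢odd (suc t) (toℕ a′) (reverse-fixed⇒odd a′ a′-fixed)
  where
  t = 2 ^ depth φ
  ends : Agree (2 * t) (place {n = suc (2 * t)} (λ ())) (place {n = 2 * suc t} (λ ()))
  ends = ends-Agree (≤-trans (n≤1+n _) (n≤1+n _)) (≤-trans (*-monoʳ-≤ 2 (n≤1+n t)) (n≤1+n _))
  partner : ∃ λ a′ → Agree t (place (middle t ∷ₑ λ ())) (place (a′ ∷ₑ λ ()))
  partner = extend-place (m^n>0 2 (depth φ)) ends (middle t)
  a′ = proj₁ partner
  middle⇔a′ : (reverse , middle t ⊨ φ) ⇔ (reverse , a′ ⊨ φ)
  middle⇔a′ =
    reverse-Sat-⇔ φ (Agree-pullback id (place-cong const≗∷ₑ) (place-cong const≗∷ₑ) (proj₂ partner))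
  a′-fixed : IsFixedPoint reverse a′
  a′-fixed = to (φ-defines _ reverse a′)
                 (to middle⇔a′ (from (φ-defines _ reverse (middle t)) (reverse-fixes-middle t)))
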